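{- For integers $n\ge i\ge 0$, let $V_{n,i}$ be the number of G-Motzkin paths of length $n$ with exactly $i$ $\mathbf{v}$-steps. Then \[ V_{n,i}=\sum_{k=i}^{n}\binom{k}{i}\binom{n+i}{2k}C_k, \] where $C_k=\frac{1}{k+1}\binom{2k}{k}$ is the $k$-th Catalan number.
   Context: A G-Motzkin path of length $n$ is a lattice path from $(0,0)$ to $(n,0)$ that never goes below the $x$-axis and consists of up steps $\mathbf{u}=(1,1)$, down steps $\mathbf{d}=(1,-1)$, horizontal steps $\mathbf{h}=(1,0)$ and vertical steps $\mathbf{v}=(0,-1)$. -}

module Defs where

open import Data.Nat using (ℕ; zero; suc; _+_; _*_; _∸_; _/_; _≡ᵇ_)
open import Data.Nat.Combinatorics using (_C_)
open import Data.Bool using (Bool; true; false; _∧_)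
open import Data.List using (List; []; _∷_; map; applyUpTo)
open import Data.Nat.ListAction using (sum)
open import Data.Product using (Σ; _×_)
open import Relation.Binary.PropositionalEquality using (_≡_)

-- Steps of a G-Motzkin path: u = (1,1), d = (1,-1), h = (1,0), v = (0,-1).
data Step : Set where
  U D H V : Step

staysAboveEndsAt0 : ℕ → List Step → Bool
staysAboveEndsAt0 ht       []      = ht ≡ᵇ 0
staysAboveEndsAt0 ht       (U ∷ s) = staysAboveEndsAt0 (suc ht) s
staysAboveEndsAt0 ht       (H ∷ s) = staysAboveEndsAt0 ht s
staysAboveEndsAt0 zero     (D ∷ s) = false
staysAboveEndsAt0 (suc ht) (D ∷ s) = staysAboveEndsAt0 ht s
staysAboveEndsAt0 zero     (V ∷ s) = false
staysAboveEndsAt0 (suc ht) (V ∷ s) = staysAboveEndsAt0 ht s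

width : List Step → ℕ
width []      = 0
width (V ∷ s) = width s
width (_ ∷ s) = suc (width s)

vCount : List Step → ℕ
vCount []      = 0
vCount (V ∷ s) = suc (vCount s)
vCount (_ ∷ s) = vCount s

GMotzkinV : ℕ → ℕ → Set
GMotzkinV n i = Σ (List Step) λ p →
  (staysAboveEndsAt0 0 p ≡ true) × (width p ≡ n) × (vCount p ≡ i)

catalan : ℕ → ℕ
catalan k = ((2 * k) C k) / suc k

formula : ℕ → ℕ → ℕ
formula n i = sum (map (λ k → (k C i) * (((n + i) C (2 * k)) * catalan k))
                       (applyUpTo (λ j → i + j) (suc n ∸ i)))

-- Reading a G-Motzkin path of width n with i v-steps as a step sequence of length n + i,
-- and classifying such sequences by their first step, the numbers paths h m i of
-- sequences of length m from height h to the axis satisfy a first-step recurrence.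
-- Forgetting which descents are v-steps leaves a Motzkin path (u, d, h only) with k
-- up-steps and h + k descents, of which any i may be turned into v-steps; so
-- paths h m i = Σ_k motzkin h m k · C(h + k, i). A Motzkin path in turn is a choice of
-- the positions of its h + 2k non-horizontal steps and a ballot path on them, so
-- motzkin h m k = C(m, h + 2k) · ballot h k, and ballot 0 k is the Catalan number by the
-- reflection principle. For h = 0 and m = n + i only the terms with i ≤ k ≤ n survive.
module Submission where

open import Defs
open import Axiom.UniquenessOfIdentityProofs using (module Decidable⇒UIP)
open import Data.Bool using (Bool; true)
import Data.Bool.Properties as Bool
open import Data.Empty using (⊥; ⊥-elim)
open import Data.Fin using (Fin; zero)
open import Data.Fin.Properties using (+↔⊎; 0↔⊥)
open import Data.List using (List; []; _∷_; length; map; applyUpTo)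
open import Data.Nat using (ℕ; zero; suc; _+_; _*_; _/_; _∸_; _≤_; _<_; z≤n; s≤s)
open import Data.Nat.Combinatorics using (_C_; nCk+nC[k+1]≡[n+1]C[k+1]; k>n⇒nCk≡0; nC1≡n)
open import Data.Nat.DivMod using (m*n/n≡m)
open import Data.Nat.ListAction using (sum)
open import Data.Nat.Properties
open import Data.Nat.Tactic.RingSolver using (solve-∀; solve)
open import Data.Product using (Σ; _×_; _,_; proj₁)
open import Data.Sum using (_⊎_; inj₁; inj₂)
open import Data.Sum.Function.Propositional using (_⊎-↔_)
open import Function using (_∘_)
open import Function.Bundles using (_↔_; mk↔ₛ′)
open import Function.Properties.Inverse using (↔-trans; ↔-sym; ↔-refl)
open import Relation.Binary.PropositionalEquality
  using (_≡_; refl; sym; trans; cong; cong₂; subst; subst₂; module ≡-Reasoning)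
open import Relation.Nullary using (¬_; Irrelevant)

open ≡-Reasoning

sumTo : ℕ → (ℕ → ℕ) → ℕ
sumTo N f = sum (applyUpTo f N)

map-applyUpTo : ∀ {A B : Set} (g : A → B) (f : ℕ → A) n →
                map g (applyUpTo f n) ≡ applyUpTo (g ∘ f) n
map-applyUpTo g f zero    = refl
map-applyUpTo g f (suc n) = cong (g (f 0) ∷_) (map-applyUpTo g (f ∘ suc) n)

sumTo-cong : ∀ N {f g : ℕ → ℕ} → (∀ k → f k ≡ g k) → sumTo N f ≡ sumTo N g
sumTo-cong zero    f≗g = refl
sumTo-cong (suc N) f≗g = cong₂ _+_ (f≗g 0) (sumTo-cong N (f≗g ∘ suc))

sumTo-+ : ∀ N (f g : ℕ → ℕ) → sumTo N (λ k → f k + g k) ≡ sumTo N f + sumTo N g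
sumTo-+ zero    f g = refl
sumTo-+ (suc N) f g = begin
  f 0 + g 0 + sumTo N (λ k → f (suc k) + g (suc k))
    ≡⟨ cong (f 0 + g 0 +_) (sumTo-+ N (f ∘ suc) (g ∘ suc)) ⟩
  f 0 + g 0 + (sumTo N (f ∘ suc) + sumTo N (g ∘ suc))
    ≡⟨ +-+-exchange (f 0) (g 0) (sumTo N (f ∘ suc)) (sumTo N (g ∘ suc)) ⟩
  f 0 + sumTo N (f ∘ suc) + (g 0 + sumTo N (g ∘ suc)) ∎
  where
  +-+-exchange : ∀ a b c d → a + b + (c + d) ≡ a + c + (b + d)
  +-+-exchange = solve-∀

sumTo-vanishing : ∀ N {f : ℕ → ℕ} → (∀ k → k < N → f k ≡ 0) → sumTo N f ≡ 0
sumTo-vanishing zero    f≡0 = refl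
sumTo-vanishing (suc N) f≡0 =
  cong₂ _+_ (f≡0 0 (s≤s z≤n)) (sumTo-vanishing N (λ k k<N → f≡0 (suc k) (s≤s k<N)))

sumTo-split : ∀ a b (f : ℕ → ℕ) → sumTo (a + b) f ≡ sumTo a f + sumTo b (λ k → f (a + k))
sumTo-split zero    b f = refl
sumTo-split (suc a) b f =
  trans (cong (f 0 +_) (sumTo-split a b (f ∘ suc))) (sym (+-assoc (f 0) _ _))

sumTo-window : ∀ {N} a L (f : ℕ → ℕ) →
               (∀ k → k < a → f k ≡ 0) → (∀ k → a + L ≤ k → f k ≡ 0) → a + L ≤ N →
               sumTo N f ≡ sumTo L (λ j → f (a + j))
sumTo-window a L f below above a+L≤N with m≤n⇒∃[o]m+o≡n a+L≤N
... | r , refl = begin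
  sumTo (a + L + r) f
    ≡⟨ sumTo-split (a + L) r f ⟩
  sumTo (a + L) f + sumTo r (λ j → f (a + L + j))
    ≡⟨ cong (sumTo (a + L) f +_) (sumTo-vanishing r (λ j _ → above _ (m≤m+n (a + L) j))) ⟩
  sumTo (a + L) f + 0
    ≡⟨ +-identityʳ _ ⟩
  sumTo (a + L) f
    ≡⟨ sumTo-split a L f ⟩
  sumTo a f + sumTo L (λ j → f (a + j))
    ≡⟨ cong (_+ sumTo L (λ j → f (a + j))) (sumTo-vanishing a below) ⟩
  sumTo L (λ j → f (a + j)) ∎

pascal : ∀ n k → suc n C suc k ≡ n C k + n C suc k
pascal n k = sym (nCk+nC[k+1]≡[n+1]C[k+1] n k)

[1+k]*nC[1+k]+k*nCk≡n*nCk : ∀ n k → suc k * (n C suc k) + k * (n C k) ≡ n * (n C k)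
[1+k]*nC[1+k]+k*nCk≡n*nCk zero    zero    = refl
[1+k]*nC[1+k]+k*nCk≡n*nCk zero    (suc k) = cong₂ _+_ (*-zeroʳ (2 + k)) (*-zeroʳ (suc k))
[1+k]*nC[1+k]+k*nCk≡n*nCk (suc n) zero    = begin
  1 * (suc n C 1) + 0 ≡⟨ cong (λ x → 1 * x + 0) (nC1≡n (suc n)) ⟩
  1 * suc n + 0       ≡⟨ solve (n ∷ []) ⟩
  suc n * 1           ∎
[1+k]*nC[1+k]+k*nCk≡n*nCk (suc n) (suc k)
  rewrite pascal n k | pascal n (suc k) = begin
    (2 + k) * (b + c) + (1 + k) * (a + b)
      ≡⟨ regroup k a b c ⟩
    ((2 + k) * c + (1 + k) * b) + ((1 + k) * b + k * a) + (b + a)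
      ≡⟨ cong (_+ (b + a)) (cong₂ _+_ ([1+k]*nC[1+k]+k*nCk≡n*nCk n (suc k))
                                      ([1+k]*nC[1+k]+k*nCk≡n*nCk n k)) ⟩
    n * b + n * a + (b + a)
      ≡⟨ factor n a b ⟩
    suc n * (a + b) ∎
  where
  a = n C k
  b = n C suc k
  c = n C suc (suc k)
  regroup : ∀ k a b c → (2 + k) * (b + c) + (1 + k) * (a + b) ≡
                        ((2 + k) * c + (1 + k) * b) + ((1 + k) * b + k * a) + (b + a)
  regroup = solve-∀
  factor : ∀ n a b → n * b + n * a + (b + a) ≡ suc n * (a + b)
  factor = solve-∀

-- ballot h k counts the paths with k up- and h + k down-steps from height h to the axis
-- that never go below it.
ballot : ℕ → ℕ → ℕ
ballot h       zero    = 1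
ballot zero    (suc k) = ballot 1 k
ballot (suc h) (suc k) = ballot (suc (suc h)) k + ballot h (suc k)

h+2*[1+k]≡2+[h+2*k] : ∀ h k → h + 2 * suc k ≡ 2 + (h + 2 * k)
h+2*[1+k]≡2+[h+2*k] = solve-∀

-- The reflection principle: n C (t + 1) counts the paths that do go below the axis. The
-- indices are passed as equations so that each case can fix them in successor form.
ballot-reflection : ∀ h k {n t} → n ≡ h + 2 * k → t ≡ h + k → ballot h k + n C suc t ≡ n C k
ballot-reflection h zero refl refl = cong suc (k>n⇒nCk≡0 (n<1+n (h + 0)))
ballot-reflection zero (suc k) n≡ refl =
  subst (λ n → ballot 1 k + n C suc (suc k) ≡ n C suc k)
        (sym (trans n≡ (h+2*[1+k]≡2+[h+2*k] 0 k))) (begin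
    ballot 1 k + suc M C suc (suc k)
      ≡⟨ cong (ballot 1 k +_) (pascal M (suc k)) ⟩
    ballot 1 k + (M C suc k + M C suc (suc k))
      ≡⟨ x+[y+z]≡x+z+y (ballot 1 k) (M C suc k) (M C suc (suc k)) ⟩
    ballot 1 k + M C suc (suc k) + M C suc k
      ≡⟨ cong (_+ M C suc k) (ballot-reflection 1 k refl refl) ⟩
    M C k + M C suc k
      ≡⟨ pascal M k ⟨
    suc M C suc k ∎)
  where
  M = suc (2 * k)
  x+[y+z]≡x+z+y : ∀ x y z → x + (y + z) ≡ x + z + y
  x+[y+z]≡x+z+y = solve-∀
ballot-reflection (suc h) (suc k) n≡ t≡ =
  subst₂ (λ n t → ballot (suc h) (suc k) + n C suc t ≡ n C suc k)
         (sym (trans n≡ (cong suc (h+2*[1+k]≡2+[h+2*k] h k))))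
         (sym (trans t≡ (cong suc (+-suc h k))))
  (begin
    (b₁ + b₂) + suc M C suc s                   ≡⟨ cong (b₁ + b₂ +_) (pascal M s) ⟩
    (b₁ + b₂) + (M C s + M C suc s)             ≡⟨ interleave b₁ b₂ (M C s) (M C suc s) ⟩
    (b₁ + M C suc s) + (b₂ + M C s)
      ≡⟨ cong₂ _+_ (ballot-reflection (2 + h) k refl refl)
                   (ballot-reflection h (suc k) (sym (h+2*[1+k]≡2+[h+2*k] h k)) (sym (+-suc h k))) ⟩
    M C k + M C suc k                           ≡⟨ pascal M k ⟨
    suc M C suc k                               ∎)
  where
  M = 2 + (h + 2 * k)
  s = 2 + (h + k)
  b₁ = ballot (2 + h) k
  b₂ = ballot h (suc k)
  interleave : ∀ a b c d → (a + b) + (c + d) ≡ (a + d) + (b + c)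
  interleave = solve-∀

ballot0*[1+k]≡[2k]Ck : ∀ k → ballot 0 k * suc k ≡ (2 * k) C k
ballot0*[1+k]≡[2k]Ck k = +-cancelʳ-≡ (k * c) _ _ (begin
  b * suc k + k * c      ≡⟨ cong (b * suc k +_) [1+k]*d≡k*c ⟨
  b * suc k + suc k * d  ≡⟨ factor b d k ⟩
  suc k * (b + d)        ≡⟨ cong (suc k *_) (ballot-reflection 0 k refl refl) ⟩
  suc k * c              ∎)
  where
  b = ballot 0 k
  c = (2 * k) C k
  d = (2 * k) C suc k
  factor : ∀ b d k → b * suc k + suc k * d ≡ suc k * (b + d)
  factor = solve-∀
  twice : ∀ k c → 2 * k * c ≡ k * c + k * c
  twice = solve-∀
  [1+k]*d≡k*c : suc k * d ≡ k * c
  [1+k]*d≡k*c = +-cancelʳ-≡ (k * c) _ _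
    (trans ([1+k]*nC[1+k]+k*nCk≡n*nCk (2 * k) k) (twice k c))

ballot0≡catalan : ∀ k → ballot 0 k ≡ catalan k
ballot0≡catalan k = begin
  ballot 0 k                   ≡⟨ m*n/n≡m (ballot 0 k) (suc k) ⟨
  ballot 0 k * suc k / suc k   ≡⟨ cong (_/ suc k) (ballot0*[1+k]≡[2k]Ck k) ⟩
  ((2 * k) C k) / suc k        ∎

both-zero : ℕ → ℕ → ℕ
both-zero zero zero = 1
both-zero _    _    = 0

-- motzkin h m k counts the step sequences of length m over u, d, h from height h to the
-- axis that never go below it and have k up-steps; upFirst and downFirst count those
-- that start with u and with d.
motzkin upFirst downFirst : ℕ → ℕ → ℕ → ℕ
motzkin h zero    k = both-zero h k
motzkin h (suc m) k = upFirst h m k + (motzkin h m k + downFirst h m k)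
upFirst h m zero    = 0
upFirst h m (suc k) = motzkin (suc h) m k
downFirst zero    m k = 0
downFirst (suc h) m k = motzkin h m k

motzkin≡C*ballot : ∀ m h k {j} → j ≡ h + 2 * k → motzkin h m k ≡ (m C j) * ballot h k
motzkin≡C*ballot zero    zero    zero    refl = refl
motzkin≡C*ballot zero    zero    (suc k) refl = refl
motzkin≡C*ballot zero    (suc h) k       refl = refl
motzkin≡C*ballot (suc m) zero    zero    refl = cong (_+ 0) (motzkin≡C*ballot m 0 0 refl)
motzkin≡C*ballot (suc m) zero    (suc k) j≡ =
  subst (λ j → motzkin 0 (suc m) (suc k) ≡ (suc m C j) * b)
        (sym (trans j≡ (h+2*[1+k]≡2+[h+2*k] 0 k))) (begin
    motzkin 1 m k + (motzkin 0 m (suc k) + 0)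
      ≡⟨ cong₂ (λ x y → x + (y + 0)) (motzkin≡C*ballot m 1 k refl)
               (motzkin≡C*ballot m 0 (suc k) (sym (h+2*[1+k]≡2+[h+2*k] 0 k))) ⟩
    (m C J) * b + ((m C suc J) * b + 0)  ≡⟨ regroup (m C J) (m C suc J) b ⟩
    (m C J + m C suc J) * b              ≡⟨ cong (_* b) (pascal m J) ⟨
    (suc m C suc J) * b                  ∎)
  where
  J = suc (2 * k)
  b = ballot 1 k
  regroup : ∀ x y b → x * b + (y * b + 0) ≡ (x + y) * b
  regroup = solve-∀
motzkin≡C*ballot (suc m) (suc h) zero    refl = begin
  0 + (motzkin (suc h) m 0 + motzkin h m 0)
    ≡⟨ cong₂ (λ x y → 0 + (x + y)) (motzkin≡C*ballot m (suc h) 0 refl)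
                                   (motzkin≡C*ballot m h 0 refl) ⟩
  0 + ((m C suc (h + 0)) * 1 + (m C (h + 0)) * 1)  ≡⟨ regroup (m C (h + 0)) (m C suc (h + 0)) ⟩
  (m C (h + 0) + m C suc (h + 0)) * 1              ≡⟨ cong (_* 1) (pascal m (h + 0)) ⟨
  (suc m C suc (h + 0)) * 1                        ∎
  where
  regroup : ∀ x y → 0 + (y * 1 + x * 1) ≡ (x + y) * 1
  regroup = solve-∀
motzkin≡C*ballot (suc m) (suc h) (suc k) j≡ =
  subst (λ j → motzkin (suc h) (suc m) (suc k) ≡ (suc m C j) * (b₁ + b₂))
        (sym (trans j≡ (cong suc J≡))) (begin
    motzkin (2 + h) m k + (motzkin (suc h) m (suc k) + motzkin h m (suc k))
      ≡⟨ cong₂ (λ x y → x + y)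
           (motzkin≡C*ballot m (2 + h) k refl)
           (cong₂ _+_ (motzkin≡C*ballot m (suc h) (suc k) (sym (cong suc J≡)))
                      (motzkin≡C*ballot m h (suc k) (sym J≡))) ⟩
    (m C J) * b₁ + ((m C suc J) * (b₁ + b₂) + (m C J) * b₂)
      ≡⟨ regroup (m C J) (m C suc J) b₁ b₂ ⟩
    (m C J + m C suc J) * (b₁ + b₂)
      ≡⟨ cong (_* (b₁ + b₂)) (pascal m J) ⟨
    (suc m C suc J) * (b₁ + b₂) ∎)
  where
  J = 2 + (h + 2 * k)
  J≡ : h + 2 * suc k ≡ J
  J≡ = h+2*[1+k]≡2+[h+2*k] h k
  b₁ = ballot (2 + h) k
  b₂ = ballot h (suc k)
  regroup : ∀ x y b₁ b₂ → x * b₁ + (y * (b₁ + b₂) + x * b₂) ≡ (x + y) * (b₁ + b₂)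
  regroup = solve-∀

-- paths h m i counts the step sequences of length m from height h to the axis that never go
-- below it and have i v-steps; descents h m i counts those that start with d or v.
paths descents : ℕ → ℕ → ℕ → ℕ
paths h zero    i = both-zero h i
paths h (suc m) i = paths (suc h) m i + (paths h m i + descents h m i)
descents zero    m i       = 0
descents (suc h) m zero    = paths h m zero
descents (suc h) m (suc i) = paths h m (suc i) + paths h m i

descents≡sum-downFirst : ∀ {m N} →
  (∀ h i → paths h m i ≡ sumTo N (λ k → motzkin h m k * ((h + k) C i))) →
  ∀ h i → descents h m i ≡ sumTo N (λ k → downFirst h m k * ((h + k) C i))
descents≡sum-downFirst {N = N} IH zero    i       = sym (sumTo-vanishing N (λ _ _ → refl))
descents≡sum-downFirst         IH (suc h) zero    = IH h zero
descents≡sum-downFirst {m} {N} IH (suc h) (suc i) = begin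
  paths h m (suc i) + paths h m i
    ≡⟨ cong₂ _+_ (IH h (suc i)) (IH h i) ⟩
  sumTo N (λ k → M k * ((h + k) C suc i)) + sumTo N (λ k → M k * ((h + k) C i))
    ≡⟨ sumTo-+ N _ _ ⟨
  sumTo N (λ k → M k * ((h + k) C suc i) + M k * ((h + k) C i))
    ≡⟨ sumTo-cong N (λ k → trans (sym (*-distribˡ-+ (M k) _ _))
                                 (cong (M k *_) (pascal′ (h + k)))) ⟩
  sumTo N (λ k → M k * (suc (h + k) C suc i)) ∎
  where
  M : ℕ → ℕ
  M = motzkin h m
  pascal′ : ∀ n → n C suc i + n C i ≡ suc n C suc i
  pascal′ n = trans (+-comm (n C suc i) (n C i)) (sym (pascal n i))

paths≡sum-motzkin : ∀ m {N} → m < N →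
  ∀ h i → paths h m i ≡ sumTo N (λ k → motzkin h m k * ((h + k) C i))
paths≡sum-motzkin zero {suc N} _ zero    zero    = cong suc (sym (sumTo-vanishing N (λ _ _ → refl)))
paths≡sum-motzkin zero {suc N} _ zero    (suc i) = sym (sumTo-vanishing N (λ _ _ → refl))
paths≡sum-motzkin zero {suc N} _ (suc h) i       = sym (sumTo-vanishing N (λ _ _ → refl))
paths≡sum-motzkin (suc m) {suc N} (s≤s m<N) h i = begin
  paths (suc h) m i + (paths h m i + descents h m i)
    ≡⟨ cong₂ _+_ upFirst-sum (cong₂ _+_ (IH h i) (descents≡sum-downFirst {N = suc N} IH h i)) ⟩
  S upTerm + (S motTerm + S downTerm)
    ≡⟨ cong (S upTerm +_) (sumTo-+ (suc N) motTerm downTerm) ⟨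
  S upTerm + S (λ k → motTerm k + downTerm k)
    ≡⟨ sumTo-+ (suc N) upTerm (λ k → motTerm k + downTerm k) ⟨
  S (λ k → upTerm k + (motTerm k + downTerm k))
    ≡⟨ sumTo-cong (suc N) (λ k → distrib (upFirst h m k) (motzkin h m k) (downFirst h m k) (c k)) ⟩
  S (λ k → motzkin h (suc m) k * c k) ∎
  where
  S : (ℕ → ℕ) → ℕ
  S = sumTo (suc N)
  c upTerm motTerm downTerm : ℕ → ℕ
  c k = (h + k) C i
  upTerm k = upFirst h m k * c k
  motTerm k = motzkin h m k * c k
  downTerm k = downFirst h m k * c k
  IH : ∀ h i → paths h m i ≡ sumTo (suc N) (λ k → motzkin h m k * ((h + k) C i))
  IH = paths≡sum-motzkin m (m<n⇒m<1+n m<N)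
  upFirst-sum : paths (suc h) m i ≡ S upTerm
  upFirst-sum = trans (paths≡sum-motzkin m m<N (suc h) i)
    (sumTo-cong N (λ k → cong (λ n → motzkin (suc h) m k * (n C i)) (sym (+-suc h k))))
  distrib : ∀ u x d c → u * c + (x * c + d * c) ≡ (u + (x + d)) * c
  distrib = solve-∀

Paths : ℕ → ℕ → ℕ → Set
Paths h m i = Σ (List Step) λ p →
  (staysAboveEndsAt0 h p ≡ true) × (length p ≡ m) × (vCount p ≡ i)

Descents : ℕ → ℕ → ℕ → Set
Descents zero    m i       = ⊥
Descents (suc h) m zero    = Paths h m zero
Descents (suc h) m (suc i) = Paths h m (suc i) ⊎ Paths h m i

Σ-≡-irrelevant : ∀ {A : Set} {P : A → Set} → (∀ {a} → Irrelevant (P a)) →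
                 {x y : Σ A P} → proj₁ x ≡ proj₁ y → x ≡ y
Σ-≡-irrelevant irr {a , u} {.a , v} refl = cong (a ,_) (irr u v)

constraints-irrelevant : ∀ {b : Bool} {l m v i : ℕ} → Irrelevant ((b ≡ true) × (l ≡ m) × (v ≡ i))
constraints-irrelevant (s , l , v) (s′ , l′ , v′) =
  cong₂ _,_ (Decidable⇒UIP.≡-irrelevant Bool._≟_ s s′)
            (cong₂ _,_ (≡-irrelevant l l′) (≡-irrelevant v v′))

same-path : ∀ {h m i} {x y : Paths h m i} → proj₁ x ≡ proj₁ y → x ≡ y
same-path = Σ-≡-irrelevant constraints-irrelevant

FirstStep : ℕ → ℕ → ℕ → Set
FirstStep h m i = Paths (suc h) m i ⊎ (Paths h m i ⊎ Descents h m i)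

uncons : ∀ h m i → Paths h (suc m) i → FirstStep h m i
uncons h       m i       ([] , _ , () , _)
uncons h       m i       (U ∷ p , s , l , v) = inj₁ (p , s , suc-injective l , v)
uncons h       m i       (H ∷ p , s , l , v) = inj₂ (inj₁ (p , s , suc-injective l , v))
uncons zero    m i       (D ∷ p , () , _)
uncons (suc h) m zero    (D ∷ p , s , l , v) = inj₂ (inj₂ (p , s , suc-injective l , v))
uncons (suc h) m (suc i) (D ∷ p , s , l , v) = inj₂ (inj₂ (inj₁ (p , s , suc-injective l , v)))
uncons zero    m i       (V ∷ p , () , _)
uncons (suc h) m zero    (V ∷ p , _ , _ , ())
uncons (suc h) m (suc i) (V ∷ p , s , l , v) =
  inj₂ (inj₂ (inj₂ (p , s , suc-injective l , suc-injective v)))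

cons : ∀ h m i → FirstStep h m i → Paths h (suc m) i
cons h       m i       (inj₁ (p , s , l , v))               = U ∷ p , s , cong suc l , v
cons h       m i       (inj₂ (inj₁ (p , s , l , v)))        = H ∷ p , s , cong suc l , v
cons zero    m i       (inj₂ (inj₂ ()))
cons (suc h) m zero    (inj₂ (inj₂ (p , s , l , v)))        = D ∷ p , s , cong suc l , v
cons (suc h) m (suc i) (inj₂ (inj₂ (inj₁ (p , s , l , v)))) = D ∷ p , s , cong suc l , v
cons (suc h) m (suc i) (inj₂ (inj₂ (inj₂ (p , s , l , v)))) = V ∷ p , s , cong suc l , cong suc v

uncons∘cons : ∀ h m i x → uncons h m i (cons h m i x) ≡ x
uncons∘cons h       m i       (inj₁ _)               = cong inj₁ (same-path refl)
uncons∘cons h       m i       (inj₂ (inj₁ _))        = cong (inj₂ ∘ inj₁) (same-path refl)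
uncons∘cons (suc h) m zero    (inj₂ (inj₂ _))        = cong (inj₂ ∘ inj₂) (same-path refl)
uncons∘cons (suc h) m (suc i) (inj₂ (inj₂ (inj₁ _))) = cong (inj₂ ∘ inj₂ ∘ inj₁) (same-path refl)
uncons∘cons (suc h) m (suc i) (inj₂ (inj₂ (inj₂ _))) = cong (inj₂ ∘ inj₂ ∘ inj₂) (same-path refl)

cons∘uncons : ∀ h m i x → cons h m i (uncons h m i x) ≡ x
cons∘uncons h       m i       ([] , _ , () , _)
cons∘uncons h       m i       (U ∷ _ , _)          = same-path refl
cons∘uncons h       m i       (H ∷ _ , _)          = same-path refl
cons∘uncons zero    m i       (D ∷ _ , () , _)
cons∘uncons (suc h) m zero    (D ∷ _ , _)          = same-path refl
cons∘uncons (suc h) m (suc i) (D ∷ _ , _)          = same-path refl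
cons∘uncons zero    m i       (V ∷ _ , () , _)
cons∘uncons (suc h) m zero    (V ∷ _ , _ , _ , ())
cons∘uncons (suc h) m (suc i) (V ∷ _ , _)          = same-path refl

Paths↔FirstStep : ∀ h m i → Paths h (suc m) i ↔ FirstStep h m i
Paths↔FirstStep h m i = mk↔ₛ′ (uncons h m i) (cons h m i) (uncons∘cons h m i) (cons∘uncons h m i)

¬A⇒A↔Fin0 : ∀ {A : Set} → ¬ A → A ↔ Fin 0
¬A⇒A↔Fin0 ¬a = mk↔ₛ′ (⊥-elim ∘ ¬a) (λ ()) (λ ()) (⊥-elim ∘ ¬a)

⊎-↔-Fin+ : ∀ {A B : Set} {a b} → A ↔ Fin a → B ↔ Fin b → (A ⊎ B) ↔ Fin (a + b)
⊎-↔-Fin+ A↔a B↔b = ↔-trans (A↔a ⊎-↔ B↔b) (↔-sym +↔⊎)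

Paths↔Fin-zero : ∀ h i → Paths h zero i ↔ Fin (both-zero h i)
Paths↔Fin-zero zero    zero    = mk↔ₛ′ (λ _ → zero) (λ _ → [] , refl , refl , refl)
  (λ { zero → refl }) (λ { ([] , _) → same-path refl ; (_ ∷ _ , _ , () , _) })
Paths↔Fin-zero zero    (suc i) = ¬A⇒A↔Fin0 λ { ([] , _ , _ , ()) ; (_ ∷ _ , _ , () , _) }
Paths↔Fin-zero (suc h) i       = ¬A⇒A↔Fin0 λ { ([] , () , _) ; (_ ∷ _ , _ , () , _) }

Paths↔Fin : ∀ m h i → Paths h m i ↔ Fin (paths h m i)
Paths↔Fin zero    h i = Paths↔Fin-zero h i
Paths↔Fin (suc m) h i = ↔-trans (Paths↔FirstStep h m i)
  (⊎-↔-Fin+ (Paths↔Fin m (suc h) i) (⊎-↔-Fin+ (Paths↔Fin m h i) (Descents↔Fin h i)))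
  where
  Descents↔Fin : ∀ h i → Descents h m i ↔ Fin (descents h m i)
  Descents↔Fin zero    i       = ↔-sym 0↔⊥
  Descents↔Fin (suc h) zero    = Paths↔Fin m h zero
  Descents↔Fin (suc h) (suc i) = ⊎-↔-Fin+ (Paths↔Fin m h (suc i)) (Paths↔Fin m h i)

width+vCount≡length : ∀ p → width p + vCount p ≡ length p
width+vCount≡length []      = refl
width+vCount≡length (U ∷ p) = cong suc (width+vCount≡length p)
width+vCount≡length (D ∷ p) = cong suc (width+vCount≡length p)
width+vCount≡length (H ∷ p) = cong suc (width+vCount≡length p)
width+vCount≡length (V ∷ p) = trans (+-suc (width p) (vCount p)) (cong suc (width+vCount≡length p))

GMotzkinV↔Paths : ∀ n i → GMotzkinV n i ↔ Paths 0 (n + i) i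
GMotzkinV↔Paths n i = mk↔ₛ′
  (λ { (p , s , w , v) → p , s , trans (sym (width+vCount≡length p)) (cong₂ _+_ w v) , v })
  (λ { (p , s , l , v) → p , s , width≡ p l v , v })
  (λ _ → same-path refl)
  (λ _ → Σ-≡-irrelevant constraints-irrelevant refl)
  where
  width≡ : ∀ p → length p ≡ n + i → vCount p ≡ i → width p ≡ n
  width≡ p l v = +-cancelʳ-≡ i (width p) n
    (trans (cong (width p +_) (sym v)) (trans (width+vCount≡length p) l))

paths≡formula : ∀ n i → i ≤ n → paths 0 (n + i) i ≡ formula n i
paths≡formula n i i≤n = begin
  paths 0 (n + i) i
    ≡⟨ paths≡sum-motzkin (n + i) (n<1+n (n + i)) 0 i ⟩
  sumTo (suc (n + i)) (λ k → motzkin 0 (n + i) k * (k C i))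
    ≡⟨ sumTo-cong (suc (n + i)) motzkin*C≡summand ⟩
  sumTo (suc (n + i)) summand
    ≡⟨ sumTo-window i L summand below-i above-n i+L≤1+n+i ⟩
  sumTo L (summand ∘ (i +_))
    ≡⟨ cong sum (map-applyUpTo summand (i +_) L) ⟨
  formula n i ∎
  where
  L = suc n ∸ i
  summand : ℕ → ℕ
  summand k = (k C i) * (((n + i) C (2 * k)) * catalan k)
  motzkin*C≡summand : ∀ k → motzkin 0 (n + i) k * (k C i) ≡ summand k
  motzkin*C≡summand k = begin
    motzkin 0 (n + i) k * (k C i)
      ≡⟨ cong (_* (k C i)) (motzkin≡C*ballot (n + i) 0 k refl) ⟩
    ((n + i) C (2 * k)) * ballot 0 k * (k C i)
      ≡⟨ cong (λ b → ((n + i) C (2 * k)) * b * (k C i)) (ballot0≡catalan k) ⟩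
    ((n + i) C (2 * k)) * catalan k * (k C i)
      ≡⟨ *-comm _ (k C i) ⟩
    summand k ∎
  i+L≡1+n : i + L ≡ suc n
  i+L≡1+n = m+[n∸m]≡n (m≤n⇒m≤1+n i≤n)
  i+L≤1+n+i : i + L ≤ suc (n + i)
  i+L≤1+n+i = subst (_≤ suc (n + i)) (sym i+L≡1+n) (s≤s (m≤m+n n i))
  below-i : ∀ k → k < i → summand k ≡ 0
  below-i k k<i = cong (_* (((n + i) C (2 * k)) * catalan k)) (k>n⇒nCk≡0 k<i)
  above-n : ∀ k → i + L ≤ k → summand k ≡ 0
  above-n k i+L≤k =
    trans (cong (λ c → (k C i) * (c * catalan k)) (k>n⇒nCk≡0 n+i<2k)) (*-zeroʳ (k C i))
    where
    1+n≤k : suc n ≤ k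
    1+n≤k = subst (_≤ k) i+L≡1+n i+L≤k
    n+i<2k : n + i < 2 * k
    n+i<2k = ≤-<-trans (+-monoʳ-≤ n i≤n)
      (subst (n + n <_) (cong (k +_) (sym (+-identityʳ k))) (+-mono-< 1+n≤k 1+n≤k))

theorem2p3 : (n i : ℕ) → i ≤ n → GMotzkinV n i ↔ Fin (formula n i)
theorem2p3 n i i≤n =
  ↔-trans (GMotzkinV↔Paths n i)
    (↔-trans (Paths↔Fin (n + i) 0 i)
      (subst (λ c → Fin (paths 0 (n + i) i) ↔ Fin c) (paths≡formula n i i≤n) ↔-refl))
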